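{- Let $U$ be a consistent subset of $D$. Then $G(U)\cap F(U)=\emptyset$.
   Context: $L$ is an MA (mathematically agreeable) language: its syntax contains a countable syntax of first-order predicate logic with equality, with natural numbers and numerals (their names) as terms; $L$ is fully interpreted (each sentence of $L$ is either true or false in its interpretation, not both); the classical truth tables hold for $\neg,\vee,\wedge,\rightarrow,\leftrightarrow$ on sentences of $L$; and the classical truth rules hold for $\forall xP(x)$, $\exists xP(x)$ for predicates $P$ of $L$. $T$ is a monadic predicate letter not in $L$. $\mathcal L$ is the language whose basic sentences are the sentences of $L$, the sentences $T(\mathbf n)$ with $\mathbf n$ a numeral, and $\forall xT(x)$, $\exists xT(x)$, $\forall x\neg T(x)$, $\exists x\neg T(x)$, closed under $\neg,\vee,\wedge,\rightarrow,\leftrightarrow$. A Gödel numbering of $\mathcal L$ is fixed; $\#A$ is the Gödel number of $A$, $\lceil A\rceil$ the numeral of $\#A$. $D$ is the set of Gödel numbers of sentences of $\mathcal L$; $W$ is the set of Gödel numbers of true sentences of $L$. A subset $U\subseteq D$ is consistent if there is no sentence $A$ of $\mathcal L$ with both $\#A\in U$ and $\#[\neg A]\in U$. For $U\subseteq D$ put $D_1(U)=\{\#T(\mathbf n):\mathbf n=\lceil A\rceil,\ \#A\in U\}$ and $D_2(U)=\{\#[\neg T(\mathbf n)]:\mathbf n=\lceil A\rceil,\ \#[\neg A]\in U\}$ ($A$ ranging over sentences of $\mathcal L$). Define $G_0(U)$: if $U=\emptyset$, $G_0(U)=W$; if $\emptyset\subsetneq U\subsetneq D$ and $D_2(U)=\emptyset$,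 $G_0(U)=W\cup D_1(U)\cup\{\#[\exists xT(x)],\#[\neg\forall x\neg T(x)]\}$; if $\emptyset\subsetneq U\subsetneq D$ and $D_2(U)\ne\emptyset$, $G_0(U)=W\cup D_1(U)\cup D_2(U)\cup\{\#[\exists xT(x)],\#[\neg\forall x\neg T(x)],\#[\neg\forall xT(x)],\#[\exists x\neg T(x)]\}$; if $U=D$, $G_0(U)=W\cup D_1(U)\cup D_2(U)\cup\{\#[\exists xT(x)],\#[\neg\exists xT(x)],\#[\forall xT(x)],\#[\neg\forall xT(x)],\#[\forall x\neg T(x)],\#[\neg\forall x\neg T(x)],\#[\exists x\neg T(x)],\#[\neg\exists x\neg T(x)]\}$. Given $G_n(U)$ ($A,B$ sentences of $\mathcal L$): $G_n^1=\{\#[A\vee B]:\#A\text{ or }\#B\in G_n(U)\}$; $G_n^2=\{\#[A\wedge B]:\#A,\#B\in G_n(U)\}$; $G_n^3=\{\#[A\rightarrow B]:\#[\neg A]\text{ or }\#B\in G_n(U)\}$; $G_n^4=\{\#[A\leftrightarrow B]:\text{both }\#A,\#B\text{ or both }\#[\neg A],\#[\neg B]\in G_n(U)\}$; $G_n^5=\{\#[\neg(A\vee B)]:\#[\neg A],\#[\neg B]\in G_n(U)\}$; $G_n^6=\{\#[\neg(A\wedge B)]:\#[\neg A]\text{ or }\#[\neg B]\in G_n(U)\}$; $G_n^7=\{\#[\neg(A\rightarrow B)]:\#A,\#[\neg B]\in G_n(U)\}$; $G_n^8=\{\#[\neg(A\leftrightarrow B)]:\text{both }\#A,\#[\neg B]\text{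 or both }\#[\neg A],\#B\in G_n(U)\}$; $G_n^9=\{\#[\neg(\neg A)]:\#A\in G_n(U)\}$; and $G_{n+1}(U)=G_n(U)\cup\bigcup_{k=1}^9G_n^k$. Then $G(U)=\bigcup_{n\ge0}G_n(U)$ and $F(U)=\{\#A:\#[\neg A]\in G(U)\}$. -}

module Defs where

open import Data.Nat using (ℕ; zero; suc)
open import Data.Bool using (Bool; true; false; not; _∧_; _∨_)
open import Data.Product using (Σ; _×_; ∃; _,_)
open import Data.Sum using (_⊎_)
open import Data.Empty using (⊥)
open import Relation.Nullary using (¬_)
open import Relation.Binary.PropositionalEquality using (_≡_)
open import Function.Definitions using (Injective)

-- Sentences of the extended language 𝓛.
-- `Prime` is the type of sentences of L that are not built by one of the
-- propositional connectives ¬,∨,∧,→,↔ (atomic and quantified sentences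
-- of L); the sentences of L are the connective closure of these.
-- T n is T(𝐧) for the numeral 𝐧 of n.

data Sent (Prime : Set) : Set where
  prim  : Prime → Sent Prime
  T     : ℕ → Sent Prime
  ∀T    : Sent Prime
  ∃T    : Sent Prime
  ∀¬T   : Sent Prime
  ∃¬T   : Sent Prime
  ~_    : Sent Prime → Sent Prime
  _∨'_  : Sent Prime → Sent Prime → Sent Prime
  _∧'_  : Sent Prime → Sent Prime → Sent Prime
  _⇒'_  : Sent Prime → Sent Prime → Sent Prime
  _⇔'_  : Sent Prime → Sent Prime → Sent Prime

data IsL {Prime : Set} : Sent Prime → Set where
  prim : ∀ p → IsL (prim p)
  ~_   : ∀ {A} → IsL A → IsL (~ A)
  _∨'_ : ∀ {A B} → IsL A → IsL B → IsL (A ∨' B)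
  _∧'_ : ∀ {A B} → IsL A → IsL B → IsL (A ∧' B)
  _⇒'_ : ∀ {A B} → IsL A → IsL B → IsL (A ⇒' B)
  _⇔'_ : ∀ {A B} → IsL A → IsL B → IsL (A ⇔' B)

iff : Bool → Bool → Bool
iff true  b = b
iff false b = not b

evalL : {Prime : Set} → (Prime → Bool) → {A : Sent Prime} → IsL A → Bool
evalL v (prim p) = v p
evalL v (~ a) = not (evalL v a)
evalL v (a ∨' b) = evalL v a ∨ evalL v b
evalL v (a ∧' b) = evalL v a ∧ evalL v b
evalL v (a ⇒' b) = not (evalL v a) ∨ evalL v b
evalL v (a ⇔' b) = iff (evalL v a) (evalL v b)

record Setup : Set₁ where
  field
    Prime : Set
    val   : Prime → Bool
    gn    : Sent Prime → ℕ
    gn-inj : Injective _≡_ _≡_ gn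

module _ (S : Setup) where
  open Setup S

  Pred : Set₁
  Pred = ℕ → Set

  D : Pred
  D k = Σ (Sent Prime) λ A → gn A ≡ k

  W : Pred
  W k = Σ (Sent Prime) λ A → Σ (IsL A) λ a → evalL val a ≡ true × gn A ≡ k

  Consistent : Pred → Set
  Consistent U = ¬ (Σ (Sent Prime) λ A → U (gn A) × U (gn (~ A)))

  _⊆D : Pred → Set
  U ⊆D = ∀ k → U k → D k

  D1 : Pred → Pred
  D1 U k = Σ (Sent Prime) λ A → U (gn A) × k ≡ gn (T (gn A))

  D2 : Pred → Pred
  D2 U k = Σ (Sent Prime) λ A → U (gn (~ A)) × k ≡ gn (~ T (gn A))

  Empty : Pred → Set
  Empty X = ∀ k → ¬ X k

  -- D ⊆ U  (together with U ⊆ D this is U = D)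
  Full : Pred → Set
  Full U = ∀ k → D k → U k

  G0 : Pred → Pred
  G0 U k =
      (Empty U × W k)
    ⊎ (¬ Empty U × ¬ Full U × Empty (D2 U) ×
        (W k ⊎ D1 U k ⊎ k ≡ gn ∃T ⊎ k ≡ gn (~ ∀¬T)))
    ⊎ (¬ Empty U × ¬ Full U × ¬ Empty (D2 U) ×
        (W k ⊎ D1 U k ⊎ D2 U k ⊎ k ≡ gn ∃T ⊎ k ≡ gn (~ ∀¬T)
             ⊎ k ≡ gn (~ ∀T) ⊎ k ≡ gn ∃¬T))
    ⊎ (Full U ×
        (W k ⊎ D1 U k ⊎ D2 U k ⊎ k ≡ gn ∃T ⊎ k ≡ gn (~ ∃T)
             ⊎ k ≡ gn ∀T ⊎ k ≡ gn (~ ∀T) ⊎ k ≡ gn ∀¬T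
             ⊎ k ≡ gn (~ ∀¬T) ⊎ k ≡ gn ∃¬T ⊎ k ≡ gn (~ ∃¬T)))

  -- one closure step: the sets G_n^1 … G_n^9 for X = G_n(U)
  Step : Pred → Pred
  Step X k =
      (Σ (Sent Prime) λ A → Σ (Sent Prime) λ B → k ≡ gn (A ∨' B) × (X (gn A) ⊎ X (gn B)))
    ⊎ (Σ (Sent Prime) λ A → Σ (Sent Prime) λ B → k ≡ gn (A ∧' B) × X (gn A) × X (gn B))
    ⊎ (Σ (Sent Prime) λ A → Σ (Sent Prime) λ B → k ≡ gn (A ⇒' B) × (X (gn (~ A)) ⊎ X (gn B)))
    ⊎ (Σ (Sent Prime) λ A → Σ (Sent Prime) λ B → k ≡ gn (A ⇔' B) ×
         ((X (gn A) × X (gn B)) ⊎ (X (gn (~ A)) × X (gn (~ B)))))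
    ⊎ (Σ (Sent Prime) λ A → Σ (Sent Prime) λ B → k ≡ gn (~ (A ∨' B)) × X (gn (~ A)) × X (gn (~ B)))
    ⊎ (Σ (Sent Prime) λ A → Σ (Sent Prime) λ B → k ≡ gn (~ (A ∧' B)) × (X (gn (~ A)) ⊎ X (gn (~ B))))
    ⊎ (Σ (Sent Prime) λ A → Σ (Sent Prime) λ B → k ≡ gn (~ (A ⇒' B)) × X (gn A) × X (gn (~ B)))
    ⊎ (Σ (Sent Prime) λ A → Σ (Sent Prime) λ B → k ≡ gn (~ (A ⇔' B)) ×
         ((X (gn A) × X (gn (~ B))) ⊎ (X (gn (~ A)) × X (gn B))))
    ⊎ (Σ (Sent Prime) λ A → k ≡ gn (~ (~ A)) × X (gn A))

  Gn : ℕ → Pred → Pred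
  Gn zero    U = G0 U
  Gn (suc n) U k = Gn n U k ⊎ Step (Gn n U) k

  G : Pred → Pred
  G U k = Σ ℕ λ n → Gn n U k

  F : Pred → Pred
  F U k = Σ (Sent Prime) λ A → k ≡ gn A × G U (gn (~ A))

-- Read U as a partial interpretation of the truth predicate:
-- T(⌜A⌝) is true when #A ∈ U and false when #¬A ∈ U; ∃xT(x), ∃x¬T(x) are
-- true and ∀xT(x), ∀x¬T(x) false; sentences of L keep their classical
-- value; compound sentences follow the strong Kleene tables.  This gives a
-- partial model with separate predicates "true" and "false".
--   * PartialModel: for any extension/anti-extension of T, a true sentence
--     of L is true in the model, and if the two are disjoint no sentence is
--     both true and false.
--   * Soundness: for consistent U every seed of G₀(U) is true (the case
--     U = D cannot occur, since D is inconsistent), and each closure step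
--     G_n ↦ G_{n+1} only adds true sentences; hence everything in G(U) is true.
-- If #A ∈ G(U) ∩ F(U), then A and ¬A are both in G(U), so A is both true
-- and false, which exclusivity forbids.
module Submission where

open import Defs
open import Data.Nat using (ℕ; zero; suc)
open import Data.Bool using (Bool; true; false; not; _∧_; _∨_)
open import Data.Empty using (⊥; ⊥-elim)
open import Data.Unit using (⊤; tt)
open import Data.Product using (Σ; _×_; _,_)
open import Data.Sum using (_⊎_; inj₁; inj₂; [_,_]′)
open import Relation.Binary.PropositionalEquality using (_≡_; refl; sym; trans; subst)

module PartialModel {Prime : Set} (v : Prime → Bool) (E⁺ E⁻ : ℕ → Set) where

  IsTrue IsFalse : Sent Prime → Set
  IsTrue (prim p)   = v p ≡ true
  IsTrue (T m)      = E⁺ m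
  IsTrue ∀T         = ⊥
  IsTrue ∃T         = ⊤
  IsTrue ∀¬T        = ⊥
  IsTrue ∃¬T        = ⊤
  IsTrue (~ A)      = IsFalse A
  IsTrue (A ∨' B)   = IsTrue A ⊎ IsTrue B
  IsTrue (A ∧' B)   = IsTrue A × IsTrue B
  IsTrue (A ⇒' B)   = IsFalse A ⊎ IsTrue B
  IsTrue (A ⇔' B)   = (IsTrue A × IsTrue B) ⊎ (IsFalse A × IsFalse B)
  IsFalse (prim p)  = v p ≡ false
  IsFalse (T m)     = E⁻ m
  IsFalse ∀T        = ⊤
  IsFalse ∃T        = ⊥
  IsFalse ∀¬T       = ⊤
  IsFalse ∃¬T       = ⊥
  IsFalse (~ A)     = IsTrue A
  IsFalse (A ∨' B)  = IsFalse A × IsFalse B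
  IsFalse (A ∧' B)  = IsFalse A ⊎ IsFalse B
  IsFalse (A ⇒' B)  = IsTrue A × IsFalse B
  IsFalse (A ⇔' B)  = (IsTrue A × IsFalse B) ⊎ (IsFalse A × IsTrue B)

  exclusive : (∀ m → E⁺ m → E⁻ m → ⊥) → ∀ A → IsTrue A → IsFalse A → ⊥
  exclusive disj (prim p) t f = true≢false (trans (sym t) f)
    where
    true≢false : true ≡ false → ⊥
    true≢false ()
  exclusive disj (T m) t f = disj m t f
  exclusive disj (~ A) t f = exclusive disj A f t
  exclusive disj (A ∨' B) (inj₁ a) (fa , _) = exclusive disj A a fa
  exclusive disj (A ∨' B) (inj₂ b) (_ , fb) = exclusive disj B b fb
  exclusive disj (A ∧' B) (a , _) (inj₁ fa) = exclusive disj A a fa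
  exclusive disj (A ∧' B) (_ , b) (inj₂ fb) = exclusive disj B b fb
  exclusive disj (A ⇒' B) (inj₁ fa) (a , _) = exclusive disj A a fa
  exclusive disj (A ⇒' B) (inj₂ b) (_ , fb) = exclusive disj B b fb
  exclusive disj (A ⇔' B) (inj₁ (_ , b)) (inj₁ (_ , fb)) = exclusive disj B b fb
  exclusive disj (A ⇔' B) (inj₁ (a , _)) (inj₂ (fa , _)) = exclusive disj A a fa
  exclusive disj (A ⇔' B) (inj₂ (fa , _)) (inj₁ (a , _)) = exclusive disj A a fa
  exclusive disj (A ⇔' B) (inj₂ (_ , fb)) (inj₂ (_ , b)) = exclusive disj B b fb

  Holds : Bool → Sent Prime → Set
  Holds true  A = IsTrue A
  Holds false A = IsFalse A

  ~-table : ∀ {A} x → Holds x A → Holds (not x) (~ A)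
  ~-table true  a = a
  ~-table false a = a

  ∨-table : ∀ {A B} x y → Holds x A → Holds y B → Holds (x ∨ y) (A ∨' B)
  ∨-table true  _     a _ = inj₁ a
  ∨-table false true  _ b = inj₂ b
  ∨-table false false a b = a , b

  ∧-table : ∀ {A B} x y → Holds x A → Holds y B → Holds (x ∧ y) (A ∧' B)
  ∧-table true  true  a b = a , b
  ∧-table true  false _ b = inj₂ b
  ∧-table false _     a _ = inj₁ a

  ⇒-table : ∀ {A B} x y → Holds x A → Holds y B → Holds (not x ∨ y) (A ⇒' B)
  ⇒-table true  true  _ b = inj₂ b
  ⇒-table true  false a b = a , b
  ⇒-table false _     a _ = inj₁ a

  ⇔-table : ∀ {A B} x y → Holds x A → Holds y B → Holds (iff x y) (A ⇔' B)
  ⇔-table true  true  a b = inj₁ (a , b)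
  ⇔-table true  false a b = inj₁ (a , b)
  ⇔-table false true  a b = inj₂ (a , b)
  ⇔-table false false a b = inj₂ (a , b)

  evalL-holds : ∀ {A} (a : IsL A) → Holds (evalL v a) A
  evalL-holds (prim p) with v p in eq
  ... | true  = eq
  ... | false = eq
  evalL-holds (~ a)    = ~-table (evalL v a) (evalL-holds a)
  evalL-holds (a ∨' b) = ∨-table (evalL v a) (evalL v b) (evalL-holds a) (evalL-holds b)
  evalL-holds (a ∧' b) = ∧-table (evalL v a) (evalL v b) (evalL-holds a) (evalL-holds b)
  evalL-holds (a ⇒' b) = ⇒-table (evalL v a) (evalL v b) (evalL-holds a) (evalL-holds b)
  evalL-holds (a ⇔' b) = ⇔-table (evalL v a) (evalL v b) (evalL-holds a) (evalL-holds b)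

  true-in-L : ∀ {A} (a : IsL A) → evalL v a ≡ true → IsTrue A
  true-in-L a e = subst (λ b → Holds b _) e (evalL-holds a)

pattern G¹ A B e h   = inj₁ (A , B , e , h)
pattern G² A B e a b = inj₂ (inj₁ (A , B , e , a , b))
pattern G³ A B e h   = inj₂ (inj₂ (inj₁ (A , B , e , h)))
pattern G⁴ A B e h   = inj₂ (inj₂ (inj₂ (inj₁ (A , B , e , h))))
pattern G⁵ A B e a b = inj₂ (inj₂ (inj₂ (inj₂ (inj₁ (A , B , e , a , b)))))
pattern G⁶ A B e h   = inj₂ (inj₂ (inj₂ (inj₂ (inj₂ (inj₁ (A , B , e , h))))))
pattern G⁷ A B e a b = inj₂ (inj₂ (inj₂ (inj₂ (inj₂ (inj₂ (inj₁ (A , B , e , a , b)))))))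
pattern G⁸ A B e h   = inj₂ (inj₂ (inj₂ (inj₂ (inj₂ (inj₂ (inj₂ (inj₁ (A , B , e , h))))))))
pattern G⁹ A e a     = inj₂ (inj₂ (inj₂ (inj₂ (inj₂ (inj₂ (inj₂ (inj₂ (A , e , a))))))))

module Soundness (S : Setup) (U : ℕ → Set) (con : Consistent S U) where
  open Setup S

  Ext Anti : ℕ → Set
  Ext  m = Σ (Sent Prime) λ A → U (gn A) × m ≡ gn A
  Anti m = Σ (Sent Prime) λ A → U (gn (~ A)) × m ≡ gn A

  open PartialModel val Ext Anti public

  ext-anti-disjoint : ∀ m → Ext m → Anti m → ⊥
  ext-anti-disjoint m (A , u , e) (A′ , u′ , e′) with gn-inj (trans (sym e) e′)
  ... | refl = con (A , u , u′)

  by-code : ∀ {C E} → gn C ≡ gn E → IsTrue E → IsTrue C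
  by-code e t = subst IsTrue (sym (gn-inj e)) t

  seed : ∀ {C} E → IsTrue E → gn C ≡ gn E → IsTrue C
  seed E t e = by-code e t

  SoundFor : (ℕ → Set) → Set
  SoundFor X = ∀ C → X (gn C) → IsTrue C

  W-sound : SoundFor (W S)
  W-sound C (A , a , ev , e) = by-code (sym e) (true-in-L a ev)

  D1-sound : SoundFor (D1 S U)
  D1-sound C (A , u , e) = by-code e (A , u , refl)

  D2-sound : SoundFor (D2 S U)
  D2-sound C (A , u , e) = by-code e (A , u , refl)

  -- A consistent U is never all of D, as D contains both ∃xT(x) and its negation.
  not-full : Full S U → ⊥
  not-full full = con (∃T , full _ (∃T , refl) , full _ (~ ∃T , refl))

  G0-sound : SoundFor (G0 S U)
  G0-sound C (inj₁ (_ , w)) = W-sound C w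
  G0-sound C (inj₂ (inj₁ (_ , _ , _ , k∈))) =
    [ W-sound C , [ D1-sound C , [ seed ∃T tt , seed (~ ∀¬T) tt ]′ ]′ ]′ k∈
  G0-sound C (inj₂ (inj₂ (inj₁ (_ , _ , _ , k∈)))) =
    [ W-sound C , [ D1-sound C , [ D2-sound C , [ seed ∃T tt ,
    [ seed (~ ∀¬T) tt , [ seed (~ ∀T) tt , seed ∃¬T tt ]′ ]′ ]′ ]′ ]′ ]′ k∈
  G0-sound C (inj₂ (inj₂ (inj₂ (full , _)))) = ⊥-elim (not-full full)

  Step-sound : ∀ {X} → SoundFor X → SoundFor (Step S X)
  Step-sound ih C (G¹ A B e (inj₁ a))       = by-code e (inj₁ (ih A a))
  Step-sound ih C (G¹ A B e (inj₂ b))       = by-code e (inj₂ (ih B b))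
  Step-sound ih C (G² A B e a b)            = by-code e (ih A a , ih B b)
  Step-sound ih C (G³ A B e (inj₁ na))      = by-code e (inj₁ (ih (~ A) na))
  Step-sound ih C (G³ A B e (inj₂ b))       = by-code e (inj₂ (ih B b))
  Step-sound ih C (G⁴ A B e (inj₁ (a , b))) = by-code e (inj₁ (ih A a , ih B b))
  Step-sound ih C (G⁴ A B e (inj₂ (na , nb))) = by-code e (inj₂ (ih (~ A) na , ih (~ B) nb))
  Step-sound ih C (G⁵ A B e na nb)          = by-code e (ih (~ A) na , ih (~ B) nb)
  Step-sound ih C (G⁶ A B e (inj₁ na))      = by-code e (inj₁ (ih (~ A) na))
  Step-sound ih C (G⁶ A B e (inj₂ nb))      = by-code e (inj₂ (ih (~ B) nb))
  Step-sound ih C (G⁷ A B e a nb)           = by-code e (ih A a , ih (~ B) nb)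
  Step-sound ih C (G⁸ A B e (inj₁ (a , nb))) = by-code e (inj₁ (ih A a , ih (~ B) nb))
  Step-sound ih C (G⁸ A B e (inj₂ (na , b))) = by-code e (inj₂ (ih (~ A) na , ih B b))
  Step-sound ih C (G⁹ A e a)                = by-code e (ih A a)

  Gn-sound : ∀ n → SoundFor (Gn S n U)
  Gn-sound zero    = G0-sound
  Gn-sound (suc n) C = [ Gn-sound n C , Step-sound {Gn S n U} (Gn-sound n) C ]′

  G-sound : SoundFor (G S U)
  G-sound C (n , g) = Gn-sound n C g

lemma4p1 : (S : Setup) (U : ℕ → Set) → _⊆D S U → Consistent S U →
           ∀ k → G S U k → F S U k → ⊥
lemma4p1 S U _ con k g (A , refl , g¬) =
  exclusive ext-anti-disjoint A (G-sound A g) (G-sound (~ A) g¬)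
  where open Soundness S U con
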